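{- If a $v_3$ configuration has a proper $n_3$ subconfiguration, then it has a proper $(v-n)_3$ subconfiguration.
   Context: A $w_3$ configuration is a set system consisting of $w$ lines, each a 3-subset of the point set, such that any two points lie in at most one common line and every point lies in exactly three lines (it then has exactly $w$ points). An $n_3$ subconfiguration of a $v_3$ configuration is a subset of its lines which, together with the union of these lines as point set, is an $n_3$ configuration; it is proper if $n<v$. -}

module Defs where

open import Data.Nat using (ℕ; _<_; _≥_)
open import Data.Bool using (Bool; true; _∧_)
open import Data.Fin using (Fin)
open import Data.Fin.Subset using (Subset; ∣_∣; _∈_)
open import Data.Vec using (tabulate; lookup)
open import Data.List using (allFin)
open import Data.Bool.ListAction using (any)
open import Data.Product using (_×_; Σ)
open import Relation.Binary.PropositionalEquality using (_≡_; _≢_)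

record Config (v : ℕ) : Set where
  field
    inc : Fin v → Fin v → Bool        -- inc l p = true  iff  point p lies on line l
    line-size : ∀ (l : Fin v) → ∣ tabulate (inc l) ∣ ≡ 3
    point-deg : ∀ (p : Fin v) → ∣ tabulate (λ l → inc l p) ∣ ≡ 3
    linear : ∀ (p q l m : Fin v) → p ≢ q →
             inc l p ≡ true → inc l q ≡ true →
             inc m p ≡ true → inc m q ≡ true → l ≡ m

module _ {v : ℕ} (C : Config v) where
  open Config C

  degIn : Subset v → Fin v → ℕ
  degIn S p = ∣ tabulate (λ l → lookup S l ∧ inc l p) ∣

  pointsOf : Subset v → Subset v
  pointsOf S = tabulate (λ p → any (λ l → lookup S l ∧ inc l p) (allFin v))

  -- S (a set of lines of C), with point set the union of its lines, is an
  -- n₃ configuration.  (Lines are 3-subsets and the linearity condition is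
  -- inherited from C.)  A configuration has at least one line: n ≥ 1.
  IsSubconfig : ℕ → Subset v → Set
  IsSubconfig n S =
    n ≥ 1 × ∣ S ∣ ≡ n × ∣ pointsOf S ∣ ≡ n ×
    (∀ (p : Fin v) → p ∈ pointsOf S → degIn S p ≡ 3)

  HasProperSubconfig : ℕ → Set
  HasProperSubconfig n = n < v × Σ (Subset v) (IsSubconfig n)

-- Let S be a proper n₃ subconfiguration.  A point of S has degree 3 both in S
-- and in the whole configuration, so all its lines belong to S; a point outside
-- S trivially has none of its lines in S.  Hence the complementary line set ∁ S
-- covers exactly the v - n points outside S, each with all three of its lines,
-- so it is a (v - n)₃ subconfiguration.
module Submission where

open import Defs
open import Data.Nat using (ℕ; suc; _∸_; _<_)
open import Data.Nat.Properties using (<-irrefl; <⇒≤; ∸-monoʳ-<; m<n⇒0<n∸m)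
open import Data.Bool using (Bool; T; _∧_)
open import Data.Bool.Properties using (T-≡; T-∧)
open import Data.Fin using (Fin)
open import Data.Fin.Subset using (Subset; ∣_∣; _∈_; _∉_; _⊆_; ∁; _∩_; Nonempty)
open import Data.Fin.Subset.Properties
  using (_∈?_; nonempty?; Empty-unique; ∣⊥∣≡0; ⊆-antisym; p⊂q⇒∣p∣<∣q∣; p∩q⊆q;
         x∈p∩q⁺; x∈p∩q⁻; x∈∁p⇒x∉p; x∉p⇒x∈∁p; ∣∁p∣≡n∸∣p∣)
open import Data.Vec using (tabulate; lookup)
open import Data.Vec.Properties
  using (lookup∘tabulate; tabulate∘lookup; tabulate-cong; lookup-zipWith; []=⇒lookup; lookup⇒[]=)
open import Data.List using (allFin)
open import Data.List.Relation.Unary.Any using (satisfied)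
open import Data.List.Relation.Unary.Any.Properties using (any⁺; any⁻)
import Data.List.Membership.Propositional as List
open import Data.List.Membership.Propositional.Properties using (∈-allFin)
open import Data.Product using (∃-syntax; _×_; _,_; proj₁)
open import Function using (_∘_; Equivalence)
open import Relation.Nullary using (yes; no; contradiction)
open import Relation.Binary.PropositionalEquality using (_≡_; sym; trans; cong; subst; module ≡-Reasoning)

∈⇒T-lookup : ∀ {n} {p : Subset n} {x} → x ∈ p → T (lookup p x)
∈⇒T-lookup x∈p = Equivalence.from T-≡ ([]=⇒lookup x∈p)

T-lookup⇒∈ : ∀ {n} {p : Subset n} {x} → T (lookup p x) → x ∈ p
T-lookup⇒∈ t = lookup⇒[]= _ _ (Equivalence.to T-≡ t)

∈-tabulate⁺ : ∀ {n} {f : Fin n → Bool} {x} → T (f x) → x ∈ tabulate f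
∈-tabulate⁺ {f = f} {x = x} t = T-lookup⇒∈ (subst T (sym (lookup∘tabulate f x)) t)

∈-tabulate⁻ : ∀ {n} {f : Fin n → Bool} {x} → x ∈ tabulate f → T (f x)
∈-tabulate⁻ {f = f} {x = x} x∈ = subst T (lookup∘tabulate f x) (∈⇒T-lookup x∈)

p⊆q⇒∣p∣≡∣q∣⇒q⊆p : ∀ {n} {p q : Subset n} → p ⊆ q → ∣ p ∣ ≡ ∣ q ∣ → q ⊆ p
p⊆q⇒∣p∣≡∣q∣⇒q⊆p {p = p} p⊆q ∣p∣≡∣q∣ {x} x∈q with x ∈? p
... | yes x∈p = x∈p
... | no  x∉p = contradiction (p⊂q⇒∣p∣<∣q∣ (p⊆q , x , x∈q , x∉p)) (<-irrefl ∣p∣≡∣q∣)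

q⊆p⇒∣p∩q∣≡∣q∣ : ∀ {n} {p q : Subset n} → q ⊆ p → ∣ p ∩ q ∣ ≡ ∣ q ∣
q⊆p⇒∣p∩q∣≡∣q∣ {p = p} {q} q⊆p =
  cong ∣_∣ (⊆-antisym (p∩q⊆q p q) (λ x∈q → x∈p∩q⁺ (q⊆p x∈q , x∈q)))

∣p∣≡suc⇒Nonempty : ∀ {n k} {p : Subset n} → ∣ p ∣ ≡ suc k → Nonempty p
∣p∣≡suc⇒Nonempty {n = n} {p = p} ∣p∣≡1+k with nonempty? p
... | yes nonempty = nonempty
... | no  empty
  with () ← trans (sym ∣p∣≡1+k) (trans (cong ∣_∣ (Empty-unique empty)) (∣⊥∣≡0 n))

module _ {v : ℕ} (C : Config v) where
  open Config C

  linesThrough : Fin v → Subset v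
  linesThrough a = tabulate (λ l → inc l a)

  degIn≡∣∩linesThrough∣ : ∀ S a → degIn C S a ≡ ∣ S ∩ linesThrough a ∣
  degIn≡∣∩linesThrough∣ S a = cong ∣_∣ (begin
    tabulate (λ l → lookup S l ∧ inc l a)          ≡⟨ tabulate-cong lookup-∩ ⟩
    tabulate (lookup (S ∩ linesThrough a))         ≡⟨ tabulate∘lookup _ ⟩
    S ∩ linesThrough a                             ∎)
    where
    open ≡-Reasoning
    lookup-∩ : ∀ l → lookup S l ∧ inc l a ≡ lookup (S ∩ linesThrough a) l
    lookup-∩ l = sym (trans (lookup-zipWith _∧_ l S (linesThrough a))
                            (cong (lookup S l ∧_) (lookup∘tabulate _ l)))

  ∈-pointsOf⁺ : ∀ {S a l} → l ∈ S → l ∈ linesThrough a → a ∈ pointsOf C S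
  ∈-pointsOf⁺ {l = l} l∈S l∋a = ∈-tabulate⁺ (any⁺ _ (List.lose (∈-allFin l)
    (Equivalence.from T-∧ (∈⇒T-lookup l∈S , ∈-tabulate⁻ l∋a))))

  ∈-pointsOf⁻ : ∀ {S a} → a ∈ pointsOf C S → ∃[ l ] l ∈ S × l ∈ linesThrough a
  ∈-pointsOf⁻ a∈ with satisfied (any⁻ _ (allFin v) (∈-tabulate⁻ a∈))
  ... | l , t with Equivalence.to T-∧ t
  ...   | l∈S , l∋a = l , T-lookup⇒∈ l∈S , ∈-tabulate⁺ l∋a

  linesThrough⊆∁ : ∀ {S a} → a ∉ pointsOf C S → linesThrough a ⊆ ∁ S
  linesThrough⊆∁ a∉ l∋a = x∉p⇒x∈∁p (λ l∈S → a∉ (∈-pointsOf⁺ l∈S l∋a))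

  module _ (S : Subset v) (saturated : ∀ a → a ∈ pointsOf C S → degIn C S a ≡ 3) where

    linesThrough⊆ : ∀ {a} → a ∈ pointsOf C S → linesThrough a ⊆ S
    linesThrough⊆ {a} a∈ = proj₁ ∘ x∈p∩q⁻ S _ ∘ p⊆q⇒∣p∣≡∣q∣⇒q⊆p (p∩q⊆q S (linesThrough a)) full
      where
      full : ∣ S ∩ linesThrough a ∣ ≡ ∣ linesThrough a ∣
      full = trans (sym (degIn≡∣∩linesThrough∣ S a)) (trans (saturated a a∈) (sym (point-deg a)))

    pointsOf-∁ : pointsOf C (∁ S) ≡ ∁ (pointsOf C S)
    pointsOf-∁ = ⊆-antisym ⊆∁ ∁⊆
      where
      ⊆∁ : pointsOf C (∁ S) ⊆ ∁ (pointsOf C S)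
      ⊆∁ a∈ with ∈-pointsOf⁻ a∈
      ... | l , l∈∁S , l∋a = x∉p⇒x∈∁p (λ a∈S → x∈∁p⇒x∉p {p = S} l∈∁S (linesThrough⊆ a∈S l∋a))
      ∁⊆ : ∁ (pointsOf C S) ⊆ pointsOf C (∁ S)
      ∁⊆ {a} a∈∁ with ∣p∣≡suc⇒Nonempty (point-deg a)
      ... | l , l∋a = ∈-pointsOf⁺ (linesThrough⊆∁ {S} (x∈∁p⇒x∉p a∈∁) l∋a) l∋a

    degIn-∁ : ∀ a → a ∈ pointsOf C (∁ S) → degIn C (∁ S) a ≡ 3
    degIn-∁ a a∈ = begin
      degIn C (∁ S) a                 ≡⟨ degIn≡∣∩linesThrough∣ (∁ S) a ⟩
      ∣ ∁ S ∩ linesThrough a ∣        ≡⟨ q⊆p⇒∣p∩q∣≡∣q∣ (linesThrough⊆∁ {S} a∉) ⟩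
      ∣ linesThrough a ∣              ≡⟨ point-deg a ⟩
      3                               ∎
      where
      open ≡-Reasoning
      a∉ : a ∉ pointsOf C S
      a∉ = x∈∁p⇒x∉p (subst (a ∈_) pointsOf-∁ a∈)

  IsSubconfig-∁ : ∀ {n} S → n < v → IsSubconfig C n S → IsSubconfig C (v ∸ n) (∁ S)
  IsSubconfig-∁ S n<v (_ , ∣S∣≡n , ∣pointsOfS∣≡n , saturated) =
    m<n⇒0<n∸m n<v ,
    trans (∣∁p∣≡n∸∣p∣ S) (cong (v ∸_) ∣S∣≡n) ,
    trans (cong ∣_∣ (pointsOf-∁ S saturated))
          (trans (∣∁p∣≡n∸∣p∣ (pointsOf C S)) (cong (v ∸_) ∣pointsOfS∣≡n)) ,
    degIn-∁ S saturated

theorem8 : ∀ (v n : ℕ) (C : Config v) →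
    HasProperSubconfig C n → HasProperSubconfig C (v ∸ n)
theorem8 v n C (n<v , S , S-sub@(n≥1 , _)) =
  ∸-monoʳ-< n≥1 (<⇒≤ n<v) , ∁ S , IsSubconfig-∁ C S n<v S-sub
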